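{- Let $(\mathbb{L},\sqsubseteq)$ be a complete lattice and $\lambda\colon\mathbb{L}\to\mathbb{L}$ monotone; degrees and co-degrees are taken with respect to $\lambda$. Then, for $a,a'\in\mathbb{L}$ (whenever the degrees on the right-hand sides below are defined): (1) if $a\sqsubseteq a'$ then $\deg(a)\le\deg(a')$; (2) if $a\sqsubseteq a'$ then $\mathrm{cdeg}(a)\le\mathrm{cdeg}(a')$; (3) if $a'\ll\lambda(a)$ then $\deg(a')\le\deg(a)+1$; (4) $\deg(a\sqcup a')=\max\{\deg(a),\deg(a')\}$.
   Context: $x\ll y$: for every directed $D$ with $y\sqsubseteq\bigsqcup D$ some $d\in D$ has $x\sqsubseteq d$. Kleene iterates over ordinals: $\lambda^0(\bot)=\bot$, $\lambda^{i+1}(\bot)=\lambda(\lambda^i(\bot))$, joins at limit ordinals. $\deg(a)=\min\{i\in\mathsf{Ord}\mid a\ll\lambda^i(\bot)\}$ and $\mathrm{cdeg}(a)=\min\{i\in\mathsf{Ord}\mid\lambda^i(\bot)\not\sqsubseteq a\}$, undefined when the set is empty. -}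

module Defs where

open import Level using (Level; _⊔_) renaming (suc to lsuc)
open import Data.Empty using (⊥)
open import Data.Unit using (⊤)
open import Data.Bool using (Bool; true; false; if_then_else_)
open import Data.Product using (Σ; _×_; ∃; ∃-syntax)
open import Relation.Nullary using (¬_)
open import Relation.Binary.Structures using (IsPartialOrder)

-- Complete lattices: a partial order (up to a setoid equality _≈_) with
-- joins of all families indexed by types of the same universe level.
-- (A subset D ⊆ L is the family Σ L D → L; conversely a family f has
-- image subset; so this is the usual notion of completeness.)

data Two (ℓ : Level) : Set ℓ where
  left right : Two ℓ

record CompleteLattice (ℓ : Level) : Set (lsuc ℓ) where
  infix 4 _≈_ _⊑_
  field
    Carrier        : Set ℓ
    _≈_            : Carrier → Carrier → Set ℓ
    _⊑_            : Carrier → Carrier → Set ℓ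
    isPartialOrder : IsPartialOrder _≈_ _⊑_
    ⨆              : {I : Set ℓ} → (I → Carrier) → Carrier
    ⨆-upper        : {I : Set ℓ} (f : I → Carrier) (i : I) → f i ⊑ ⨆ f
    ⨆-least        : {I : Set ℓ} (f : I → Carrier) (u : Carrier) →
                     (∀ i → f i ⊑ u) → ⨆ f ⊑ u

  data Empty : Set ℓ where

  ⊥L : Carrier
  ⊥L = ⨆ {I = Empty} (λ ())

  _⊔L_ : Carrier → Carrier → Carrier
  a ⊔L b = ⨆ {I = Two ℓ} (λ { left → a ; right → b })

  Directed : {I : Set ℓ} → (I → Carrier) → Set ℓ
  Directed {I} f = I × (∀ i j → ∃[ k ] (f i ⊑ f k × f j ⊑ f k))

  _≪_ : Carrier → Carrier → Set (lsuc ℓ)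
  x ≪ y = {I : Set ℓ} (f : I → Carrier) → Directed f →
          y ⊑ ⨆ f → ∃[ i ] (x ⊑ f i)

data Ord (ℓ : Level) : Set (lsuc ℓ) where
  zero : Ord ℓ
  succ : Ord ℓ → Ord ℓ
  lim  : {I : Set ℓ} → (I → Ord ℓ) → Ord ℓ

mutual
  _≤o_ : {ℓ : Level} → Ord ℓ → Ord ℓ → Set ℓ
  zero   ≤o y = Data.Unit.Polymorphic.⊤
    where import Data.Unit.Polymorphic
  succ x ≤o y = x <o y
  lim f  ≤o y = ∀ i → f i ≤o y

  _<o_ : {ℓ : Level} → Ord ℓ → Ord ℓ → Set ℓ
  x <o zero   = Data.Empty.Polymorphic.⊥
    where import Data.Empty.Polymorphic
  x <o succ y = x ≤o y
  x <o lim f  = ∃[ i ] (x <o f i)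

maxo : {ℓ : Level} → Ord ℓ → Ord ℓ → Ord ℓ
maxo {ℓ} i j = lim {I = Two ℓ} (λ { left → i ; right → j })

module Kleene {ℓ : Level} (L : CompleteLattice ℓ)
              (λf : CompleteLattice.Carrier L → CompleteLattice.Carrier L) where
  open CompleteLattice L

  iter : Ord ℓ → Carrier
  iter zero     = ⊥L
  iter (succ i) = λf (iter i)
  iter (lim f)  = ⨆ (λ k → iter (f k))

  DegDefined : Carrier → Set (lsuc ℓ)
  DegDefined a = ∃[ i ] (a ≪ iter i)

  IsDeg : Carrier → Ord ℓ → Set (lsuc ℓ)
  IsDeg a i = (a ≪ iter i) × (∀ j → a ≪ iter j → i ≤o j)

  CdegDefined : Carrier → Set (lsuc ℓ)
  CdegDefined a = ∃[ i ] (¬ (iter i ⊑ a))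

  IsCdeg : Carrier → Ord ℓ → Set (lsuc ℓ)
  IsCdeg a i = (¬ (iter i ⊑ a)) × (∀ j → ¬ (iter j ⊑ a) → i ≤o j)

{-# OPTIONS --safe #-}
module Submission where

-- Each degree is a least ordinal satisfying some property, so it is bounded by
-- any ordinal satisfying that property. Witnesses come from a ⊑ a' (≪ and ⋢ are
-- antitone in their left argument), from monotonicity of λ (a' ≪ λ(a) ⊑ λ(λ^i ⊥)
-- = λ^(i+1) ⊥), and from the closure of x ≪ z under binary joins, which uses
-- directedness.

open import Level using (Level)
open import Data.Product using (_×_; _,_; ∃)
open import Relation.Nullary using (¬_)
open import Relation.Binary.Structures using (IsPartialOrder)
open import Defs

module WayBelow {ℓ : Level} (L : CompleteLattice ℓ) where
  open CompleteLattice L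
  open IsPartialOrder isPartialOrder using () renaming (refl to ⊑-refl; trans to ⊑-trans)

  x⊑x⊔y : ∀ x y → x ⊑ x ⊔L y
  x⊑x⊔y x y = ⨆-upper _ left

  y⊑x⊔y : ∀ x y → y ⊑ x ⊔L y
  y⊑x⊔y x y = ⨆-upper _ right

  ⊑-≪-trans : ∀ {x y z} → x ⊑ y → y ≪ z → x ≪ z
  ⊑-≪-trans x⊑y y≪z f dir z⊑⨆f with y≪z f dir z⊑⨆f
  ... | i , y⊑fi = i , ⊑-trans x⊑y y⊑fi

  ≪-⊑-trans : ∀ {x y z} → x ≪ y → y ⊑ z → x ≪ z
  ≪-⊑-trans x≪y y⊑z f dir z⊑⨆f = x≪y f dir (⊑-trans y⊑z z⊑⨆f)

  ≪⇒⊑ : ∀ {x y} → x ≪ y → x ⊑ y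
  ≪⇒⊑ {x} {y} x≪y with x≪y (λ (_ : Two ℓ) → y) (left , λ _ _ → left , ⊑-refl , ⊑-refl)
                           (⨆-upper (λ (_ : Two ℓ) → y) left)
  ... | _ , x⊑y = x⊑y

  ⊔-≪ : ∀ {x y z} → x ≪ z → y ≪ z → (x ⊔L y) ≪ z
  ⊔-≪ x≪z y≪z f dir@(_ , upper) z⊑⨆f
    with x≪z f dir z⊑⨆f | y≪z f dir z⊑⨆f
  ... | i , x⊑fi | j , y⊑fj with upper i j
  ... | k , fi⊑fk , fj⊑fk =
    k , ⨆-least _ (f k) λ { left → ⊑-trans x⊑fi fi⊑fk ; right → ⊑-trans y⊑fj fj⊑fk }

Least : {ℓ p : Level} → (Ord ℓ → Set p) → Ord ℓ → Set (Level.suc ℓ Level.⊔ p)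
Least P i = P i × (∀ j → P j → i ≤o j)

least-≤-witness : {ℓ p : Level} {P : Ord ℓ → Set p} {j : Ord ℓ} →
                  P j → ∃ P × (∀ i → Least P i → i ≤o j)
least-≤-witness {j = j} Pj = (j , Pj) , λ i (_ , least) → least j Pj

maxo-least : {ℓ : Level} {i i' j : Ord ℓ} → i ≤o j → i' ≤o j → maxo i i' ≤o j
maxo-least i≤j i'≤j left  = i≤j
maxo-least i≤j i'≤j right = i'≤j

module Degrees {ℓ : Level} (L : CompleteLattice ℓ)
    (λf : CompleteLattice.Carrier L → CompleteLattice.Carrier L)
    (λ-mono : ∀ {x y} → CompleteLattice._⊑_ L x y → CompleteLattice._⊑_ L (λf x) (λf y)) where
  open CompleteLattice L
  open IsPartialOrder isPartialOrder using () renaming (trans to ⊑-trans)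
  open Kleene L λf
  open WayBelow L

  deg-≤ : ∀ {a j} → a ≪ iter j → DegDefined a × (∀ i → IsDeg a i → i ≤o j)
  deg-≤ = least-≤-witness

  cdeg-≤ : ∀ {a j} → ¬ (iter j ⊑ a) → CdegDefined a × (∀ i → IsCdeg a i → i ≤o j)
  cdeg-≤ = least-≤-witness

  deg-mono : ∀ a a' i' → a ⊑ a' → IsDeg a' i' →
             DegDefined a × (∀ i → IsDeg a i → i ≤o i')
  deg-mono a a' i' a⊑a' (a'≪λⁱ' , _) = deg-≤ (⊑-≪-trans a⊑a' a'≪λⁱ')

  cdeg-mono : ∀ a a' i' → a ⊑ a' → IsCdeg a' i' →
              CdegDefined a × (∀ i → IsCdeg a i → i ≤o i')
  cdeg-mono a a' i' a⊑a' (λⁱ'⋢a' , _) =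
    cdeg-≤ (λ λⁱ'⊑a → λⁱ'⋢a' (⊑-trans λⁱ'⊑a a⊑a'))

  deg-≪λ : ∀ a a' i → a' ≪ λf a → IsDeg a i →
           DegDefined a' × (∀ k → IsDeg a' k → k ≤o succ i)
  deg-≪λ a a' i a'≪λa (a≪λⁱ , _) = deg-≤ (≪-⊑-trans a'≪λa (λ-mono (≪⇒⊑ a≪λⁱ)))

  deg-⊔ : ∀ a a' i i' → IsDeg a i → IsDeg a' i' → IsDeg (a ⊔L a') (maxo i i')
  deg-⊔ a a' i i' (a≪λⁱ , least) (a'≪λⁱ' , least') = ⊔-≪ a≪max a'≪max , least⊔
    where
    a≪max : a ≪ iter (maxo i i')
    a≪max = ≪-⊑-trans a≪λⁱ (⨆-upper _ left)

    a'≪max : a' ≪ iter (maxo i i')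
    a'≪max = ≪-⊑-trans a'≪λⁱ' (⨆-upper _ right)

    least⊔ : ∀ j → (a ⊔L a') ≪ iter j → maxo i i' ≤o j
    least⊔ j ⊔≪λʲ = maxo-least (least j (⊑-≪-trans (x⊑x⊔y a a') ⊔≪λʲ))
                               (least' j (⊑-≪-trans (y⊑x⊔y a a') ⊔≪λʲ))

lemma24 : {ℓ : Level} (L : CompleteLattice ℓ)
          (λf : CompleteLattice.Carrier L → CompleteLattice.Carrier L) →
          (∀ {x y} → CompleteLattice._⊑_ L x y → CompleteLattice._⊑_ L (λf x) (λf y)) →
          let open CompleteLattice L
              open Kleene L λf
          in
          -- (1) a ⊑ a' , deg(a') = i'  ⇒  deg(a) defined and deg(a) ≤ deg(a')
          (∀ a a' i' → a ⊑ a' → IsDeg a' i' →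
             DegDefined a × (∀ i → IsDeg a i → i ≤o i'))
          -- (2) a ⊑ a' , cdeg(a') = i'  ⇒  cdeg(a) defined and cdeg(a) ≤ cdeg(a')
          × (∀ a a' i' → a ⊑ a' → IsCdeg a' i' →
             CdegDefined a × (∀ i → IsCdeg a i → i ≤o i'))
          -- (3) a' ≪ λ(a) , deg(a) = i  ⇒  deg(a') defined and deg(a') ≤ deg(a) + 1
          × (∀ a a' i → a' ≪ λf a → IsDeg a i →
             DegDefined a' × (∀ k → IsDeg a' k → k ≤o succ i))
          -- (4) deg(a) = i , deg(a') = i'  ⇒  deg(a ⊔ a') = max(i , i')
          × (∀ a a' i i' → IsDeg a i → IsDeg a' i' →
             IsDeg (a ⊔L a') (maxo i i'))
lemma24 L λf λ-mono = deg-mono , cdeg-mono , deg-≪λ , deg-⊔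
  where open Degrees L λf λ-mono
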